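{- Let $k,s$ be non-negative integers, $n=k+s$, and let $\ell$ satisfy $s \le \ell < n/2$ (and $\ell\ge 1$). Suppose the set of spies in a room of $n$ people labelled $1,\dots,n$ is a uniformly random $s$-element subset of $\{1,\dots,n\}$ (the rest being knights), and a questioner follows the Spider Interrogation Strategy with parameter $\ell$. Suppose the spies either all act knavishly, or all act spyishly. Then for each $q$, the probability that the questioner asks exactly $q$ questions is the same in the knavish case as in the spyish case. In either case, the expected number of questions saved, i.e. the expected value of $n+\ell-1$ minus the number of questions asked, is \[ \frac{1}{\binom{k+s}{s}} \sum_{r=0}^{s-1} \binom{k+s}{r}. \]
   Context: Setting: each person is a knight or a spy; knights always answer truthfully. Questions have the form "Person $i$, what is the identity of person $j$?", answered "knight" (a support) or "spy" (an accusation). Spies act knavishly if they always answer falsely, and spyishly if they always answer "spy". A person is "involved" once he has been a candidate or has been asked a question; the choice of which uninvolved person to use next in the strategy is made without knowledge of identities. Spider Interrogation Strategy (for at most $\ell$ spies). Step 1: Keep a threshold $L$, initially $L=\ell$. Choose as candidate a person not yet involved, and repeatedly ask new people about the candidate until either (a) strictly more people have accused the candidate than have supported him, or (b) $L$ people have supported him. In case (a), with $a$ accusers and $a-1$ supporters, reject the candidate, set aside the $2a$ people involved, replace $L$ by $L-a$ and repeat Step 1 with a new candidate. In case (b) accept the candidate, person $k$ (necessarily a knight). Step 2: ask $k$ about each person not involved in Step 1 and about each rejected candidate. Step 3: for each rejected candidate $m$ with $a$ accusers: if $m$ is a knight ask $k$ about the $a-1$ supporters of $m$; if $m$ is a spy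 ask $k$ about the $a$ accusers of $m$. Step 4: ask $k$ about each person who supported his candidacy. The number of questions asked never exceeds $n+\ell-1$. -}

module Defs where

open import Data.Bool using (Bool; true; false; not; if_then_else_)
open import Data.Nat using (ℕ; zero; suc; _+_; _*_; _∸_; _<ᵇ_; _≡ᵇ_)
open import Data.Fin using (Fin)
open import Data.List using (List; []; _∷_; _++_; [_]; length; map; filter; concatMap; allFin; upTo)
open import Data.Nat.ListAction using (sum)
open import Data.Vec using (Vec; lookup; count)
import Data.Vec as Vec
open import Data.Maybe using (Maybe; just; nothing)
open import Data.Product using (_×_; _,_)
open import Data.Nat.Combinatorics using (_C_)
open import Relation.Binary.PropositionalEquality using (_≡_)
open import Relation.Nullary.Decidable using (does)
import Data.Nat as ℕ
import Data.Bool as B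

-- A room of n people labelled by Fin n.  An assignment of identities is a
-- vector S : Vec Bool n with  lookup S i ≡ true  iff person i is a spy.
Room : ℕ → Set
Room n = Vec Bool n

spies : ∀ {n} → Room n → ℕ
spies S = count (λ b → b B.≟ true) S

allRooms : (n : ℕ) → List (Room n)
allRooms zero = Vec.[] ∷ []
allRooms (suc n) = map (false Vec.∷_) (allRooms n) ++ map (true Vec.∷_) (allRooms n)

-- all assignments with exactly s spies (the support of the uniform
-- distribution on s-element spy sets)
roomsWith : (n s : ℕ) → List (Room n)
roomsWith n s = filter (λ S → spies S ℕ.≟ s) (allRooms n)

data Behaviour : Set where
  knavish spyish : Behaviour

-- answer beh S i j : the answer of person i when asked about person j;
-- true means the answer "spy" (an accusation), false means "knight" (support).
answer : ∀ {n} → Behaviour → Room n → Fin n → Fin n → Bool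
answer knavish S i j = if lookup S i then not (lookup S j) else lookup S j
answer spyish  S i j = if lookup S i then true else lookup S j

-- a question  (i , j)  is  "Person i, what is the identity of person j?"
Question : ℕ → Set
Question n = Fin n × Fin n

data Grill (n : ℕ) : Set where
  -- accepted: supporters, accusers, people still uninvolved, questions asked
  accepted : List (Fin n) → List (Fin n) → List (Fin n) → List (Question n) → Grill n
  -- rejected: supporters, accusers, people still uninvolved, questions asked
  rejected : List (Fin n) → List (Fin n) → List (Fin n) → List (Question n) → Grill n
  -- ran out of uninvolved people (never happens under the hypotheses)
  stuck : Grill n

-- grill beh S c L sup acc rest qs : candidate c, threshold L, current
-- supporters/accusers, uninvolved people (in the fixed order in which they
-- are used), questions asked so far about c.
grill : ∀ {n} → Behaviour → Room n → Fin n → ℕ →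
        List (Fin n) → List (Fin n) → List (Fin n) → List (Question n) → Grill n
grill beh S c L sup acc rest qs =
  if length sup ≡ᵇ L then accepted sup acc rest qs
  else if length sup <ᵇ length acc then rejected sup acc rest qs
  else go rest
  where
  go : List _ → Grill _
  go [] = stuck
  go (p ∷ rest′) =
    if answer beh S p c
    then grill beh S c L sup (acc ++ [ p ]) rest′ (qs ++ [ (p , c) ])
    else grill beh S c L (sup ++ [ p ]) acc rest′ (qs ++ [ (p , c) ])

-- a rejected candidate together with its supporters and accusers
Rejected : ℕ → Set
Rejected n = Fin n × List (Fin n) × List (Fin n)

-- Outcome of Step 1: accepted candidate k, its supporters, the people not
-- involved in Step 1, the rejected candidates, all questions of Step 1.
Step1 : ℕ → Set
Step1 n = Fin n × List (Fin n) × List (Fin n) × List (Rejected n) × List (Question n)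

-- Step 1, with fuel (each round consumes at least one person, so fuel n suffices).
step1 : ∀ {n} → Behaviour → Room n → ℕ → ℕ → List (Fin n) →
        List (Rejected n) → List (Question n) → Maybe (Step1 n)
step1 beh S zero L rest rej qs = nothing
step1 beh S (suc f) L [] rej qs = nothing
step1 beh S (suc f) L (c ∷ rest) rej qs with grill beh S c L [] [] rest []
... | accepted sup acc rest′ gq = just (c , sup , rest′ , rej , qs ++ gq)
... | rejected sup acc rest′ gq =
  step1 beh S f (L ∸ length acc) rest′ (rej ++ [ (c , sup , acc) ]) (qs ++ gq)
... | stuck = nothing

laterSteps : ∀ {n} → Behaviour → Room n → Step1 n → List (Question n)
laterSteps {n} beh S (k , supk , rest , rej , qs) =
  qs ++ step2 ++ step3 ++ step4
  where
  ask : Fin n → Question n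
  ask x = (k , x)
  cand : Rejected n → Fin n
  cand (m , _ , _) = m
  step2 : List (Question n)
  step2 = map ask rest ++ map (λ r → ask (cand r)) rej
  step3 : List (Question n)
  step3 = concatMap (λ { (m , sup , acc) →
            if answer beh S k m then map ask acc else map ask sup }) rej
  step4 : List (Question n)
  step4 = map ask supk

-- Uninvolved people are used in the fixed order 0, 1, ..., n-1.
-- (If the procedure were ever stuck, which the hypotheses exclude, no
-- questions are recorded.)
spiderQuestions : ∀ {n} → Behaviour → ℕ → Room n → List (Question n)
spiderQuestions {n} beh ℓ S with step1 beh S n ℓ (allFin n) [] []
... | just r = laterSteps beh S r
... | nothing = []

numQuestions : ∀ {n} → Behaviour → ℕ → Room n → ℕ
numQuestions beh ℓ S = length (spiderQuestions beh ℓ S)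

-- number of rooms with s spies in which exactly q questions are asked
-- (the probability is this divided by  n C s)
countQ : (n s : ℕ) → Behaviour → ℕ → ℕ → ℕ
countQ n s beh ℓ q = length (filter (λ S → numQuestions beh ℓ S ℕ.≟ q) (roomsWith n s))

saved : ∀ {n} → Behaviour → ℕ → Room n → ℕ
saved {n} beh ℓ S = (n + ℓ ∸ 1) ∸ numQuestions beh ℓ S

-- total savings over all rooms with s spies
-- (the expectation is this divided by  n C s)
totalSaved : (n s : ℕ) → Behaviour → ℕ → ℕ
totalSaved n s beh ℓ = sum (map (saved beh ℓ) (roomsWith n s))

binomSum : ℕ → ℕ → ℕ
binomSum n s = sum (map (λ r → n C r) (upTo s))

module Submission where

-- Read a room person by person as a word over Bool (true = spy).  Along this
-- word, Step 1 of the strategy is a walk: the lead of a candidate over his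
-- accusers goes up and down, and the strategy saves exactly one question for
-- each knight candidate that it rejects.  The savings are therefore a
-- statistic  fresh beh w  of the word, given by three mutual recursions.  Equal tails give equal
--    distributions, and summing the tails gives Σ_{r<s} (k+s choose r).
--  * Cost analysis: while at most L of the uninvolved people are spies and
--    more than L are knights, each round of Step 1 keeps the identity
--    "questions + savings + 1 = n + ℓ" (following each grilling along the walk).
--  * The theorem: both quantities are sums over spy words of a function of
--    the savings.

open import Defs
open import Data.Bool using (Bool; true; false; if_then_else_; not; T)
open import Data.Nat
open import Data.Nat.Properties
open import Data.Nat.Combinatorics using (_C_; k>n⇒nCk≡0; nCk+nC[k+1]≡[n+1]C[k+1]; nCn≡1; nCk≡nC[n∸k])
open import Data.Nat.ListAction using (sum)
open import Data.Nat.ListAction.Properties using (sum-++)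
open import Data.Nat.Tactic.RingSolver using (solve-∀)
open import Data.List using (List; []; _∷_; _++_; [_]; length; map; filter; concatMap; applyUpTo; tabulate; allFin)
open import Data.List.Properties
  using (map-++; map-∘; map-cong; filter-++; filter-none; filter-≐; ++-identityʳ; length-++; length-map; map-tabulate; length-tabulate)
open import Data.List.Relation.Unary.All using (All; []; _∷_; universal)
import Data.List.Relation.Unary.All as All
import Data.List.Relation.Unary.All.Properties as All
open import Data.Vec using (Vec; toList; lookup) renaming (_∷_ to _∷ᵥ_; [] to []ᵥ)
open import Data.Vec.Properties using (length-toList)
open import Data.Fin using (Fin)
open import Data.Maybe using (just)
open import Data.Product using (Σ; _×_; _,_; proj₁)
open import Data.Empty using (⊥-elim)
open import Relation.Nullary using (yes; no)
open import Relation.Nullary.Decidable using (does)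
open import Relation.Unary using (Decidable)
open import Relation.Binary.PropositionalEquality hiding ([_])
open import Algebra.Properties.CommutativeSemigroup +-commutativeSemigroup
  using () renaming (interchange to +-interchange)

module _ {A : Set} where

  sum-map-All : ∀ {F G : A → ℕ} {xs} → All (λ x → F x ≡ G x) xs →
                sum (map F xs) ≡ sum (map G xs)
  sum-map-All [] = refl
  sum-map-All (e ∷ es) = cong₂ _+_ e (sum-map-All es)

  sum-map-∘ : ∀ {B : Set} (F : B → ℕ) (g : A → B) xs →
              sum (map F (map g xs)) ≡ sum (map (λ x → F (g x)) xs)
  sum-map-∘ F g xs = cong sum (sym (map-∘ xs))

  sum-map-+ : ∀ (F G : A → ℕ) xs →
              sum (map (λ x → F x + G x) xs) ≡ sum (map F xs) + sum (map G xs)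
  sum-map-+ F G [] = refl
  sum-map-+ F G (x ∷ xs) =
    trans (cong ((F x + G x) +_) (sum-map-+ F G xs)) (+-interchange (F x) (G x) _ _)

  sum-map-* : ∀ c (F : A → ℕ) xs → sum (map (λ x → c * F x) xs) ≡ c * sum (map F xs)
  sum-map-* c F [] = sym (*-zeroʳ c)
  sum-map-* c F (x ∷ xs) = trans (cong (c * F x +_) (sum-map-* c F xs)) (sym (*-distribˡ-+ c (F x) _))

  length-filter-sum : ∀ {P : A → Set} (P? : Decidable P) xs →
    length (filter P? xs) ≡ sum (map (λ x → if does (P? x) then 1 else 0) xs)
  length-filter-sum P? [] = refl
  length-filter-sum P? (x ∷ xs) with does (P? x)
  ... | true = cong suc (length-filter-sum P? xs)
  ... | false = length-filter-sum P? xs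

filter-map : ∀ {A B : Set} {P : B → Set} (P? : Decidable P) (g : A → B) xs →
             filter P? (map g xs) ≡ map g (filter (λ x → P? (g x)) xs)
filter-map P? g [] = refl
filter-map P? g (x ∷ xs) with does (P? (g x))
... | true = cong (g x ∷_) (filter-map P? g xs)
... | false = filter-map P? g xs

-- Finite sums Σ_{m<B} f m and the level indicators [m ≤ x], [x ≡ m], used to
-- recover a statistic (and its distribution) from its tails.

sumBelow : ℕ → (ℕ → ℕ) → ℕ
sumBelow zero f = 0
sumBelow (suc B) f = f 0 + sumBelow B (λ m → f (suc m))

sumBelow-cong : ∀ B {f g} → (∀ m → m < B → f m ≡ g m) → sumBelow B f ≡ sumBelow B g
sumBelow-cong zero e = refl
sumBelow-cong (suc B) e = cong₂ _+_ (e 0 z<s) (sumBelow-cong B (λ m p → e (suc m) (s<s p)))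

sumBelow-zero : ∀ B → sumBelow B (λ _ → 0) ≡ 0
sumBelow-zero zero = refl
sumBelow-zero (suc B) = sumBelow-zero B

sumBelow-snoc : ∀ B f → sumBelow (suc B) f ≡ sumBelow B f + f B
sumBelow-snoc zero f = +-identityʳ (f 0)
sumBelow-snoc (suc B) f =
  trans (cong (f 0 +_) (sumBelow-snoc B (λ m → f (suc m)))) (sym (+-assoc (f 0) _ _))

sumBelow-reverse : ∀ B f → sumBelow B (λ j → f (B ∸ suc j)) ≡ sumBelow B f
sumBelow-reverse zero f = refl
sumBelow-reverse (suc B) f =
  trans (cong (f B +_) (sumBelow-reverse B f))
        (trans (+-comm (f B) _) (sym (sumBelow-snoc B f)))

sum-applyUpTo : ∀ (g f : ℕ → ℕ) B → sum (map g (applyUpTo f B)) ≡ sumBelow B (λ m → g (f m))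
sum-applyUpTo g f zero = refl
sum-applyUpTo g f (suc B) = cong (g (f 0) +_) (sum-applyUpTo g (λ m → f (suc m)) B)

sum-sumBelow : ∀ {A : Set} B (F : ℕ → A → ℕ) xs →
  sum (map (λ x → sumBelow B (λ m → F m x)) xs) ≡ sumBelow B (λ m → sum (map (F m) xs))
sum-sumBelow zero F [] = refl
sum-sumBelow zero F (x ∷ xs) = sum-sumBelow zero F xs
sum-sumBelow (suc B) F xs =
  trans (sum-map-+ (F 0) (λ x → sumBelow B (λ m → F (suc m) x)) xs)
        (cong (sum (map (F 0) xs) +_) (sum-sumBelow B (λ m → F (suc m)) xs))

atLeast : ℕ → ℕ → ℕ
atLeast zero _ = 1
atLeast (suc m) zero = 0
atLeast (suc m) (suc x) = atLeast m x

exactly : ℕ → ℕ → ℕ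
exactly zero zero = 1
exactly zero (suc x) = 0
exactly (suc m) zero = 0
exactly (suc m) (suc x) = exactly m x

atLeast-split : ∀ m x → exactly m x + atLeast (suc m) x ≡ atLeast m x
atLeast-split zero zero = refl
atLeast-split zero (suc x) = refl
atLeast-split (suc m) zero = refl
atLeast-split (suc m) (suc x) = atLeast-split m x

sumBelow-atLeast : ∀ B x → x ≤ B → sumBelow B (λ j → atLeast (suc j) x) ≡ x
sumBelow-atLeast B zero _ = sumBelow-zero B
sumBelow-atLeast (suc B) (suc x) (s≤s x≤B) = cong suc (sumBelow-atLeast B x x≤B)

sumBelow-exactly : ∀ B (H : ℕ → ℕ) x → x < B → sumBelow B (λ m → H m * exactly m x) ≡ H x
sumBelow-exactly (suc B) H zero _ = begin
  H 0 * 1 + sumBelow B (λ m → H (suc m) * 0) ≡⟨ cong₂ _+_ (*-identityʳ (H 0)) (sumBelow-cong B (λ m _ → *-zeroʳ (H (suc m)))) ⟩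
  H 0 + sumBelow B (λ _ → 0)                 ≡⟨ cong (H 0 +_) (sumBelow-zero B) ⟩
  H 0 + 0                                    ≡⟨ +-identityʳ (H 0) ⟩
  H 0 ∎
  where open ≡-Reasoning
sumBelow-exactly (suc B) H (suc x) (s<s x<B) =
  trans (cong (_+ sumBelow B (λ m → H (suc m) * exactly m x)) (*-zeroʳ (H 0)))
        (sumBelow-exactly B (λ m → H (suc m)) x x<B)

-- A statistic f on a list is determined, in distribution, by its tail counts.

module _ {A : Set} (xs : List A) where

  levelCount : (A → ℕ) → ℕ → ℕ
  levelCount f m = sum (map (λ x → atLeast m (f x)) xs)

  sum-by-levels : ∀ B (f : A → ℕ) → All (λ x → f x ≤ B) xs →
                  sum (map f xs) ≡ sumBelow B (λ j → levelCount f (suc j))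
  sum-by-levels B f bounded =
    trans (sum-map-All (All.map (λ {x} p → sym (sumBelow-atLeast B (f x) p)) bounded))
          (sum-sumBelow B (λ j x → atLeast (suc j) (f x)) xs)

  exactCount-split : ∀ (f : A → ℕ) m →
    sum (map (λ x → exactly m (f x)) xs) + levelCount f (suc m) ≡ levelCount f m
  exactCount-split f m =
    trans (sym (sum-map-+ (λ x → exactly m (f x)) (λ x → atLeast (suc m) (f x)) xs))
          (cong sum (map-cong (λ x → atLeast-split m (f x)) xs))

  same-levels⇒same-sums : ∀ B (f g : A → ℕ) →
    All (λ x → f x < B) xs → All (λ x → g x < B) xs →
    (∀ m → levelCount f m ≡ levelCount g m) →
    ∀ H → sum (map (λ x → H (f x)) xs) ≡ sum (map (λ x → H (g x)) xs)
  same-levels⇒same-sums B f g f<B g<B levels H = begin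
    sum (map (λ x → H (f x)) xs)                          ≡⟨ expand f f<B ⟩
    sumBelow B (λ m → H m * sum (map (λ x → exactly m (f x)) xs)) ≡⟨ sumBelow-cong B (λ m _ → cong (H m *_) (same-exact m)) ⟩
    sumBelow B (λ m → H m * sum (map (λ x → exactly m (g x)) xs)) ≡⟨ expand g g<B ⟨
    sum (map (λ x → H (g x)) xs) ∎
    where
    open ≡-Reasoning
    expand : ∀ h → All (λ x → h x < B) xs →
      sum (map (λ x → H (h x)) xs) ≡ sumBelow B (λ m → H m * sum (map (λ x → exactly m (h x)) xs))
    expand h h<B =
      trans (sum-map-All (All.map (λ {x} p → sym (sumBelow-exactly B H (h x) p)) h<B))
     (trans (sum-sumBelow B (λ m x → H m * exactly m (h x)) xs)
            (sumBelow-cong B (λ m _ → sum-map-* (H m) (λ x → exactly m (h x)) xs)))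
    same-exact : ∀ m → sum (map (λ x → exactly m (f x)) xs) ≡ sum (map (λ x → exactly m (g x)) xs)
    same-exact m = +-cancelʳ-≡ (levelCount f (suc m)) _ _
      (trans (exactCount-split f m)
      (trans (levels m)
      (trans (sym (exactCount-split g m)) (cong (_ +_) (sym (levels (suc m)))))))

-- Spy patterns.  Reading a room person by person gives a word over Bool
-- (true = spy); sums over rooms become sums over words.

trues : List Bool → ℕ
trues [] = 0
trues (true ∷ w) = suc (trues w)
trues (false ∷ w) = trues w

falses : List Bool → ℕ
falses [] = 0
falses (true ∷ w) = falses w
falses (false ∷ w) = suc (falses w)

trues-cons : ∀ b w → trues w ≤ trues (b ∷ w)
trues-cons true w = n≤1+n (trues w)
trues-cons false w = ≤-refl

falses-cons : ∀ b w → falses (b ∷ w) ≤ suc (falses w)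
falses-cons true w = n≤1+n (falses w)
falses-cons false w = ≤-refl

falses+trues : ∀ w → falses w + trues w ≡ length w
falses+trues [] = refl
falses+trues (true ∷ w) = trans (+-suc (falses w) (trues w)) (cong suc (falses+trues w))
falses+trues (false ∷ w) = cong suc (falses+trues w)

trues-toList : ∀ {n} (S : Room n) → trues (toList S) ≡ spies S
trues-toList []ᵥ = refl
trues-toList (true ∷ᵥ S) = cong suc (trues-toList S)
trues-toList (false ∷ᵥ S) = trues-toList S

roomWords : ℕ → ℕ → List (List Bool)
roomWords n s = map toList (roomsWith n s)

roomWords-trues : ∀ n s → All (λ w → trues w ≡ s) (roomWords n s)
roomWords-trues n s = All.map⁺ (All.map (λ {S} e → trans (trues-toList S) e)
                                          (All.all-filter (λ S → spies S ≟ s) (allRooms n)))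

roomsWith-suc : ∀ n s → roomsWith (suc n) s ≡
  map (false ∷ᵥ_) (filter (λ S → spies (false ∷ᵥ S) ≟ s) (allRooms n)) ++
  map (true ∷ᵥ_) (filter (λ S → spies (true ∷ᵥ S) ≟ s) (allRooms n))
roomsWith-suc n s =
  trans (filter-++ P? (map (false ∷ᵥ_) (allRooms n)) (map (true ∷ᵥ_) (allRooms n)))
        (cong₂ _++_ (filter-map P? (false ∷ᵥ_) (allRooms n)) (filter-map P? (true ∷ᵥ_) (allRooms n)))
  where
  P? : Decidable (λ (S : Room (suc n)) → spies S ≡ s)
  P? S = spies S ≟ s

map-toList-cons : ∀ {n} b (R : List (Room n)) → map toList (map (b ∷ᵥ_) R) ≡ map (b ∷_) (map toList R)
map-toList-cons b R = trans (sym (map-∘ R)) (map-∘ R)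

roomWords-suc-zero : ∀ n → roomWords (suc n) 0 ≡ map (false ∷_) (roomWords n 0)
roomWords-suc-zero n = begin
  roomWords (suc n) 0
    ≡⟨ cong (map toList) (roomsWith-suc n 0) ⟩
  map toList (map (false ∷ᵥ_) (roomsWith n 0) ++ map (true ∷ᵥ_) (filter (λ S → spies (true ∷ᵥ S) ≟ 0) (allRooms n)))
    ≡⟨ cong (λ R → map toList (map (false ∷ᵥ_) (roomsWith n 0) ++ map (true ∷ᵥ_) R))
            (filter-none (λ S → spies (true ∷ᵥ S) ≟ 0) (universal (λ _ ()) (allRooms n))) ⟩
  map toList (map (false ∷ᵥ_) (roomsWith n 0) ++ [])
    ≡⟨ cong (map toList) (++-identityʳ _) ⟩
  map toList (map (false ∷ᵥ_) (roomsWith n 0))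
    ≡⟨ map-toList-cons false (roomsWith n 0) ⟩
  map (false ∷_) (roomWords n 0) ∎
  where open ≡-Reasoning

roomWords-suc-suc : ∀ n s →
  roomWords (suc n) (suc s) ≡ map (false ∷_) (roomWords n (suc s)) ++ map (true ∷_) (roomWords n s)
roomWords-suc-suc n s = begin
  roomWords (suc n) (suc s)
    ≡⟨ cong (map toList) (roomsWith-suc n (suc s)) ⟩
  map toList (map (false ∷ᵥ_) (roomsWith n (suc s)) ++ map (true ∷ᵥ_) (filter (λ S → spies (true ∷ᵥ S) ≟ suc s) (allRooms n)))
    ≡⟨ cong (λ R → map toList (map (false ∷ᵥ_) (roomsWith n (suc s)) ++ map (true ∷ᵥ_) R))
            (filter-≐ _ (λ S → spies S ≟ s) (suc-injective , cong suc) (allRooms n)) ⟩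
  map toList (map (false ∷ᵥ_) (roomsWith n (suc s)) ++ map (true ∷ᵥ_) (roomsWith n s))
    ≡⟨ map-++ toList (map (false ∷ᵥ_) (roomsWith n (suc s))) _ ⟩
  map toList (map (false ∷ᵥ_) (roomsWith n (suc s))) ++ map toList (map (true ∷ᵥ_) (roomsWith n s))
    ≡⟨ cong₂ _++_ (map-toList-cons false (roomsWith n (suc s))) (map-toList-cons true (roomsWith n s)) ⟩
  map (false ∷_) (roomWords n (suc s)) ++ map (true ∷_) (roomWords n s) ∎
  where open ≡-Reasoning

ΣR : ℕ → ℕ → (List Bool → ℕ) → ℕ
ΣR n s F = sum (map F (roomWords n s))

ΣR-suc-zero : ∀ n F → ΣR (suc n) 0 F ≡ ΣR n 0 (λ w → F (false ∷ w))
ΣR-suc-zero n F = trans (cong (λ W → sum (map F W)) (roomWords-suc-zero n))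
                        (sum-map-∘ F (false ∷_) (roomWords n 0))

ΣR-suc-suc : ∀ n s F →
  ΣR (suc n) (suc s) F ≡ ΣR n (suc s) (λ w → F (false ∷ w)) + ΣR n s (λ w → F (true ∷ w))
ΣR-suc-suc n s F = begin
  sum (map F (roomWords (suc n) (suc s)))
    ≡⟨ cong (λ W → sum (map F W)) (roomWords-suc-suc n s) ⟩
  sum (map F (map (false ∷_) (roomWords n (suc s)) ++ map (true ∷_) (roomWords n s)))
    ≡⟨ cong sum (map-++ F (map (false ∷_) (roomWords n (suc s))) _) ⟩
  sum (map F (map (false ∷_) (roomWords n (suc s))) ++ map F (map (true ∷_) (roomWords n s)))
    ≡⟨ sum-++ (map F (map (false ∷_) (roomWords n (suc s)))) _ ⟩
  sum (map F (map (false ∷_) (roomWords n (suc s)))) + sum (map F (map (true ∷_) (roomWords n s)))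
    ≡⟨ cong₂ _+_ (sum-map-∘ F (false ∷_) (roomWords n (suc s))) (sum-map-∘ F (true ∷_) (roomWords n s)) ⟩
  ΣR n (suc s) (λ w → F (false ∷ w)) + ΣR n s (λ w → F (true ∷ w)) ∎
  where open ≡-Reasoning

ΣR-empty : ∀ n s F → n < s → ΣR n s F ≡ 0
ΣR-empty zero (suc s) F _ = refl
ΣR-empty (suc n) (suc s) F (s<s n<s) =
  trans (ΣR-suc-suc n s F) (cong₂ _+_ (ΣR-empty n (suc s) _ (m<n⇒m<1+n n<s)) (ΣR-empty n s _ n<s))

ΣW : ℕ → ℕ → (List Bool → ℕ) → ℕ
ΣW k s F = ΣR (k + s) s F

ΣW-knight : ∀ k F → ΣW (suc k) 0 F ≡ ΣW k 0 (λ w → F (false ∷ w))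
ΣW-knight k F = begin
  ΣR (suc k + 0) 0 F              ≡⟨ cong (λ m → ΣR m 0 F) (+-identityʳ (suc k)) ⟩
  ΣR (suc k) 0 F                  ≡⟨ ΣR-suc-zero k F ⟩
  ΣR k 0 (λ w → F (false ∷ w))    ≡⟨ cong (λ m → ΣR m 0 _) (+-identityʳ k) ⟨
  ΣR (k + 0) 0 (λ w → F (false ∷ w)) ∎
  where open ≡-Reasoning

ΣW-spy : ∀ s F → ΣW 0 (suc s) F ≡ ΣW 0 s (λ w → F (true ∷ w))
ΣW-spy s F = trans (ΣR-suc-suc s s F) (cong (_+ ΣR s s _) (ΣR-empty s (suc s) _ (n<1+n s)))

ΣW-split : ∀ k s F →
  ΣW (suc k) (suc s) F ≡ ΣW k (suc s) (λ w → F (false ∷ w)) + ΣW (suc k) s (λ w → F (true ∷ w))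
ΣW-split k s F = trans (ΣR-suc-suc (k + suc s) s F)
                       (cong (λ m → ΣW k (suc s) (λ w → F (false ∷ w)) + ΣR m s (λ w → F (true ∷ w))) (+-suc k s))

ΣW-count : ∀ k s → ΣW k s (λ _ → 1) ≡ (k + s) C k
ΣW-count zero zero = refl
ΣW-count (suc k) zero = begin
  ΣW (suc k) 0 (λ _ → 1)  ≡⟨ ΣW-knight k _ ⟩
  ΣW k 0 (λ _ → 1)        ≡⟨ ΣW-count k 0 ⟩
  (k + 0) C k             ≡⟨ cong (_C k) (+-identityʳ k) ⟩
  k C k                   ≡⟨ nCn≡1 k ⟩
  1                       ≡⟨ nCn≡1 (suc k) ⟨
  suc k C suc k           ≡⟨ cong (_C suc k) (+-identityʳ (suc k)) ⟨
  (suc k + 0) C suc k ∎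
  where open ≡-Reasoning
ΣW-count zero (suc s) = trans (ΣW-spy s _) (ΣW-count zero s)
ΣW-count (suc k) (suc s) =
  trans (ΣW-split k s _)
 (trans (cong₂ _+_ (ΣW-count k (suc s)) (trans (ΣW-count (suc k) s) (cong (_C suc k) (sym (+-suc k s)))))
        (nCk+nC[k+1]≡[n+1]C[k+1] (k + suc s) k))

-- The savings as a statistic of the spy pattern.  While a knight is the
-- candidate, knights support him and spies of either kind accuse him; a
-- rejected knight saves one question, every other outcome saves none (this is
-- the content of the cost analysis further down).
mutual
  -- knight candidate leading by h (supporters minus accusers)
  knightRun : Behaviour → ℕ → List Bool → ℕ
  knightRun beh h [] = 0
  knightRun beh h (false ∷ w) = knightRun beh (suc h) w
  knightRun beh zero (true ∷ w) = suc (fresh beh w)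
  knightRun beh (suc h) (true ∷ w) = knightRun beh h w

  -- a new candidate is about to be chosen
  fresh : Behaviour → List Bool → ℕ
  fresh beh [] = 0
  fresh beh (false ∷ w) = knightRun beh 0 w
  fresh beh (true ∷ w) = spyRun beh 0 w

  -- spy candidate: knavish spies support him and knights accuse him (h is his
  -- lead); spyish spies and knights alike accuse him, so one answer rejects him
  spyRun : Behaviour → ℕ → List Bool → ℕ
  spyRun knavish h [] = 0
  spyRun knavish h (true ∷ w) = spyRun knavish (suc h) w
  spyRun knavish zero (false ∷ w) = fresh knavish w
  spyRun knavish (suc h) (false ∷ w) = spyRun knavish h w
  spyRun spyish h [] = 0
  spyRun spyish h (_ ∷ w) = fresh spyish w

-- Every saving is paid for by a spy accusing a knight candidate.
mutual
  knightRun≤trues : ∀ beh h w → knightRun beh h w ≤ trues w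
  knightRun≤trues beh h [] = z≤n
  knightRun≤trues beh h (false ∷ w) = knightRun≤trues beh (suc h) w
  knightRun≤trues beh zero (true ∷ w) = s≤s (fresh≤trues beh w)
  knightRun≤trues beh (suc h) (true ∷ w) = m≤n⇒m≤1+n (knightRun≤trues beh h w)

  fresh≤trues : ∀ beh w → fresh beh w ≤ trues w
  fresh≤trues beh [] = z≤n
  fresh≤trues beh (false ∷ w) = knightRun≤trues beh 0 w
  fresh≤trues beh (true ∷ w) = m≤n⇒m≤1+n (spyRun≤trues beh 0 w)

  spyRun≤trues : ∀ beh h w → spyRun beh h w ≤ trues w
  spyRun≤trues knavish h [] = z≤n
  spyRun≤trues knavish h (true ∷ w) = m≤n⇒m≤1+n (spyRun≤trues knavish (suc h) w)
  spyRun≤trues knavish zero (false ∷ w) = fresh≤trues knavish w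
  spyRun≤trues knavish (suc h) (false ∷ w) = spyRun≤trues knavish h w
  spyRun≤trues spyish h [] = z≤n
  spyRun≤trues spyish h (true ∷ w) = m≤n⇒m≤1+n (fresh≤trues spyish w)
  spyRun≤trues spyish h (false ∷ w) = fresh≤trues spyish w

pascal : ∀ m r {a b} → a ≡ m C r → b ≡ m C suc r → a + b ≡ suc m C suc r
pascal m r refl refl = nCk+nC[k+1]≡[n+1]C[k+1] m r

pascal′ : ∀ m r {a b} → a ≡ m C suc r → b ≡ m C r → a + b ≡ suc m C suc r
pascal′ m r refl refl = trans (+-comm (m C suc r) (m C r)) (nCk+nC[k+1]≡[n+1]C[k+1] m r)

C-beyond : ∀ a b c → (a + 0) C (a + suc b + c) ≡ 0
C-beyond a b c = k>n⇒nCk≡0 (begin-strict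
  a + 0         ≡⟨ +-identityʳ a ⟩
  a             <⟨ m<m+n a z<s ⟩
  a + suc b     ≤⟨ m≤m+n (a + suc b) c ⟩
  a + suc b + c ∎)
  where open ≤-Reasoning

C-beyond′ : ∀ a b → (a + 0) C (a + suc b) ≡ 0
C-beyond′ a b = k>n⇒nCk≡0 (subst (_< a + suc b) (sym (+-identityʳ a)) (m<m+n a z<s))

lead-up : ∀ k h {s} → suc s ≤ suc k + suc h → suc s ≤ k + suc (suc h)
lead-up k h {s} = subst (suc s ≤_) (sym (+-suc k (suc h)))

lead-shift : ∀ k h j → k + suc (suc h) + j ≡ suc (k + suc h + j)
lead-shift k h j = cong (_+ j) (+-suc k (suc h))

-- Tails of the savings: among the rooms of k knights and s spies, exactly
-- (k+s choose k+1+j) save more than j questions, for either behaviour.  The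
-- three statements are proved together by conditioning on the first person.
mutual
  tail-knightRun : ∀ beh k s h j → s ≤ k + suc h →
    ΣW k s (λ w → atLeast (suc j) (knightRun beh h w)) ≡ (k + s) C (k + suc h + j)
  tail-knightRun beh zero zero h j _ = refl
  tail-knightRun beh (suc k) zero h j _ =
    trans (ΣW-knight k _)
   (trans (tail-knightRun beh k zero (suc h) j z≤n)
   (trans (C-beyond k (suc h) j) (sym (C-beyond (suc k) h j))))
  tail-knightRun beh zero (suc zero) zero zero _ = refl
  tail-knightRun beh zero (suc zero) zero (suc j) _ = refl
  tail-knightRun beh zero (suc (suc s)) zero j (s≤s ())
  tail-knightRun beh zero (suc s) (suc h) j (s≤s s≤h) =
    trans (ΣW-spy s _)
   (trans (tail-knightRun beh zero s h j s≤h)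
   (trans (sym (+-identityʳ _))
   (pascal s (suc h + j) refl (sym (k>n⇒nCk≡0 (s≤s (≤-trans s≤h (m≤m+n (suc h) j))))))))
  tail-knightRun beh (suc k) (suc s) zero zero s≤ =
    trans (ΣW-split k s _)
   (pascal′ (k + suc s) (k + 1 + 0)
     (trans (tail-knightRun beh k (suc s) 1 0 (lead-up k 0 s≤)) (cong ((k + suc s) C_) (lead-shift k 0 0)))
     (trans (ΣW-count (suc k) s) (cong₂ _C_ (sym (+-suc k s)) (sym (trans (+-identityʳ (k + 1)) (+-comm k 1))))))
  tail-knightRun beh (suc k) (suc s) zero (suc j) s≤ =
    trans (ΣW-split k s _)
   (pascal′ (k + suc s) (k + 1 + suc j)
     (trans (tail-knightRun beh k (suc s) 1 (suc j) (lead-up k 0 s≤)) (cong ((k + suc s) C_) (lead-shift k 0 (suc j))))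
     (trans (tail-fresh beh (suc k) s j (≤-pred (subst (suc s ≤_) (+-comm (suc k) 1) s≤)))
            (cong₂ _C_ (sym (+-suc k s)) (cong (_+ suc j) (+-comm 1 k)))))
  tail-knightRun beh (suc k) (suc s) (suc h) j s≤ =
    trans (ΣW-split k s _)
   (pascal′ (k + suc s) (k + suc (suc h) + j)
     (trans (tail-knightRun beh k (suc s) (suc (suc h)) j (lead-up k (suc h) s≤)) (cong ((k + suc s) C_) (lead-shift k (suc h) j)))
     (trans (tail-knightRun beh (suc k) s h j (subst (s ≤_) (+-suc k (suc h)) (≤-pred s≤)))
            (cong₂ _C_ (sym (+-suc k s)) (sym (lead-shift k h j)))))

  tail-fresh : ∀ beh k s j → s ≤ k →
    ΣW k s (λ w → atLeast (suc j) (fresh beh w)) ≡ (k + s) C (k + suc j)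
  tail-fresh beh zero zero j _ = refl
  tail-fresh beh (suc k) zero j _ =
    trans (ΣW-knight k _)
   (trans (tail-knightRun beh k zero 0 j z≤n)
   (trans (C-beyond k 0 j) (sym (C-beyond′ (suc k) j))))
  tail-fresh beh (suc k) (suc s) j s≤k =
    trans (ΣW-split k s _)
   (pascal (k + suc s) (k + suc j)
     (trans (tail-knightRun beh k (suc s) 0 j (subst (suc s ≤_) (+-comm 1 k) s≤k)) (cong ((k + suc s) C_) (+-assoc k 1 j)))
     (trans (tail-spyRun beh (suc k) s 0 j (subst (_≤ suc k) (+-comm 1 s) s≤k)) (cong (_C (suc k + suc j)) (sym (+-suc k s)))))

  tail-spyRun : ∀ beh k s h j → s + suc h ≤ k →
    ΣW k s (λ w → atLeast (suc j) (spyRun beh h w)) ≡ (k + s) C (k + suc j)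
  tail-spyRun beh zero s h j s+h<0 = ⊥-elim (n≮0 (subst (_≤ 0) (+-suc s h) s+h<0))
  tail-spyRun knavish (suc k) zero zero j _ =
    trans (ΣW-knight k _)
   (trans (tail-fresh knavish k zero j z≤n) (trans (C-beyond′ k j) (sym (C-beyond′ (suc k) j))))
  tail-spyRun knavish (suc k) zero (suc h) j (s≤s h<k) =
    trans (ΣW-knight k _)
   (trans (tail-spyRun knavish k zero h j h<k) (trans (C-beyond′ k j) (sym (C-beyond′ (suc k) j))))
  tail-spyRun knavish (suc k) (suc s) zero j s+1≤ =
    trans (ΣW-split k s _)
   (pascal (k + suc s) (k + suc j)
     (tail-fresh knavish k (suc s) j (≤-pred (subst (_≤ suc k) (+-comm (suc s) 1) s+1≤)))
     (trans (tail-spyRun knavish (suc k) s 1 j (subst (_≤ suc k) (sym (+-suc s 1)) s+1≤))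
            (cong (_C (suc k + suc j)) (sym (+-suc k s)))))
  tail-spyRun knavish (suc k) (suc s) (suc h) j s+h≤ =
    trans (ΣW-split k s _)
   (pascal (k + suc s) (k + suc j)
     (tail-spyRun knavish k (suc s) h j (≤-pred (subst (_≤ suc k) (+-suc (suc s) (suc h)) s+h≤)))
     (trans (tail-spyRun knavish (suc k) s (suc (suc h)) j (subst (_≤ suc k) (sym (+-suc s (suc (suc h)))) s+h≤))
            (cong (_C (suc k + suc j)) (sym (+-suc k s)))))
  tail-spyRun spyish (suc k) zero h j _ =
    trans (ΣW-knight k _)
   (trans (tail-fresh spyish k zero j z≤n) (trans (C-beyond′ k j) (sym (C-beyond′ (suc k) j))))
  tail-spyRun spyish (suc k) (suc s) h j s+h≤ =
    trans (ΣW-split k s _)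
   (pascal (k + suc s) (k + suc j)
     (tail-fresh spyish k (suc s) j (≤-pred (≤-trans (s≤s (m≤m+n (suc s) h)) (subst (_≤ suc k) (+-suc (suc s) h) s+h≤))))
     (trans (tail-fresh spyish (suc k) s j (≤-trans (m≤m+n s (suc h)) (m≤n⇒m≤1+n (≤-pred s+h≤))))
            (cong (_C (suc k + suc j)) (sym (+-suc k s)))))

module _ (k s : ℕ) (s≤k : s ≤ k) where

  savings-bounded : ∀ beh → All (λ w → fresh beh w ≤ s) (roomWords (k + s) s)
  savings-bounded beh =
    All.map (λ {w} e → subst (fresh beh w ≤_) e (fresh≤trues beh w)) (roomWords-trues (k + s) s)

  savings-equidistributed : ∀ (H : ℕ → ℕ) →
    ΣW k s (λ w → H (fresh knavish w)) ≡ ΣW k s (λ w → H (fresh spyish w))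
  savings-equidistributed =
    same-levels⇒same-sums (roomWords (k + s) s) (suc s) (fresh knavish) (fresh spyish)
      (All.map s≤s (savings-bounded knavish)) (All.map s≤s (savings-bounded spyish)) same-tails
    where
    same-tails : ∀ m → levelCount (roomWords (k + s) s) (fresh knavish) m
                     ≡ levelCount (roomWords (k + s) s) (fresh spyish) m
    same-tails zero = refl
    same-tails (suc j) = trans (tail-fresh knavish k s j s≤k) (sym (tail-fresh spyish k s j s≤k))

  -- Summing the tails: the total savings are Σ_{j<s} (k+s choose k+1+j) = Σ_{r<s} (k+s choose r).
  savings-total : ∀ beh → ΣW k s (fresh beh) ≡ binomSum (k + s) s
  savings-total beh = begin
    ΣW k s (fresh beh)
      ≡⟨ sum-by-levels (roomWords (k + s) s) s (fresh beh) (savings-bounded beh) ⟩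
    sumBelow s (λ j → ΣW k s (λ w → atLeast (suc j) (fresh beh w)))
      ≡⟨ sumBelow-cong s (λ j _ → tail-fresh beh k s j s≤k) ⟩
    sumBelow s (λ j → (k + s) C (k + suc j))
      ≡⟨ sumBelow-cong s (λ j j<s → trans (nCk≡nC[n∸k] (+-monoʳ-≤ k j<s))
                                          (cong ((k + s) C_) ([m+n]∸[m+o]≡n∸o k s (suc j)))) ⟩
    sumBelow s (λ j → (k + s) C (s ∸ suc j))
      ≡⟨ sumBelow-reverse s ((k + s) C_) ⟩
    sumBelow s ((k + s) C_)
      ≡⟨ sum-applyUpTo ((k + s) C_) (λ r → r) s ⟨
    binomSum (k + s) s ∎
    where open ≡-Reasoning

knightRun-safe : ∀ beh h w → trues w ≤ h → knightRun beh h w ≡ 0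
knightRun-safe beh h [] _ = refl
knightRun-safe beh h (false ∷ w) p = knightRun-safe beh (suc h) w (m≤n⇒m≤1+n p)
knightRun-safe beh (suc h) (true ∷ w) (s≤s p) = knightRun-safe beh h w p

length-snoc : ∀ {A : Set} (xs : List A) y → length (xs ++ [ y ]) ≡ suc (length xs)
length-snoc xs y = trans (length-++ xs) (+-comm (length xs) 1)

-- Accounting of one round of Step 1 that rejects a candidate with a
-- accusers: Step 1 asked g questions about him, Steps 2 and 3 will ask
-- 1 + sc more, the threshold drops by a, and d = a - sc questions are saved.
-- X is the final number of questions, F the savings after the round, P the
-- questions committed before it and r′ the number of people still uninvolved.
rejection-accounting : ∀ X F P g r′ sc a L d → a ≤ L → sc + d ≡ a →
  X + F + 1 ≡ (P + g + suc sc) + r′ + (L ∸ a) → X + (d + F) + 1 ≡ P + suc (g + r′) + L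
rejection-accounting X F P g r′ sc .(sc + d) L d a≤L refl after = begin
  X + (d + F) + 1                          ≡⟨ move-saving X d F ⟩
  (X + F + 1) + d                          ≡⟨ cong (_+ d) after ⟩
  (P + g + suc sc) + r′ + (L ∸ a) + d      ≡⟨ regroup P g sc r′ d (L ∸ a) ⟩
  P + suc (g + r′) + (a + (L ∸ a))         ≡⟨ cong (P + suc (g + r′) +_) (m+[n∸m]≡n a≤L) ⟩
  P + suc (g + r′) + L ∎
  where
  open ≡-Reasoning
  a = sc + d
  move-saving : ∀ X d F → X + (d + F) + 1 ≡ (X + F + 1) + d
  move-saving = solve-∀
  regroup : ∀ P g sc r′ d m → (P + g + suc sc) + r′ + m + d ≡ P + suc (g + r′) + ((sc + d) + m)
  regroup = solve-∀

-- Cost analysis of the strategy in a fixed room S.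
module Interrogation {n : ℕ} (S : Room n) where

  spyWord : List (Fin n) → List Bool
  spyWord = map (lookup S)

  answer-about-knight : ∀ beh {c} p → lookup S c ≡ false → answer beh S p c ≡ lookup S p
  answer-about-knight knavish {c} p c-knight with lookup S p
  ... | true rewrite c-knight = refl
  ... | false rewrite c-knight = refl
  answer-about-knight spyish {c} p c-knight with lookup S p
  ... | true = refl
  ... | false = c-knight

  knavish-answer-about-spy : ∀ {c} p → lookup S c ≡ true → answer knavish S p c ≡ not (lookup S p)
  knavish-answer-about-spy {c} p c-spy with lookup S p
  ... | true rewrite c-spy = refl
  ... | false rewrite c-spy = refl

  knight-answer : ∀ beh {k} m → lookup S k ≡ false → answer beh S k m ≡ lookup S m
  knight-answer knavish m k-knight rewrite k-knight = refl
  knight-answer spyish m k-knight rewrite k-knight = refl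

  afterAnswer : Behaviour → Fin n → ℕ → List (Fin n) → List (Fin n) → Fin n →
                List (Fin n) → List (Question n) → Bool → Grill n
  afterAnswer beh c L sup acc p rest qs true = grill beh S c L sup (acc ++ [ p ]) rest (qs ++ [ (p , c) ])
  afterAnswer beh c L sup acc p rest qs false = grill beh S c L (sup ++ [ p ]) acc rest (qs ++ [ (p , c) ])

  grill-accept : ∀ beh c L sup acc rest qs → length sup ≡ L →
                 grill beh S c L sup acc rest qs ≡ accepted sup acc rest qs
  grill-accept beh c L sup acc rest qs sup≡L with length sup ≡ᵇ L in e
  ... | true = refl
  ... | false = ⊥-elim (subst T e (≡⇒≡ᵇ _ _ sup≡L))

  grill-reject : ∀ beh c L sup acc rest qs → length sup ≢ L → length sup < length acc →
                 grill beh S c L sup acc rest qs ≡ rejected sup acc rest qs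
  grill-reject beh c L sup acc rest qs sup≢L sup<acc
    with length sup ≡ᵇ L in e₁ | length sup <ᵇ length acc in e₂
  ... | true | _ = ⊥-elim (sup≢L (≡ᵇ⇒≡ _ _ (subst T (sym e₁) _)))
  ... | false | true = refl
  ... | false | false = ⊥-elim (subst T e₂ (<⇒<ᵇ sup<acc))

  grill-ask : ∀ beh c L sup acc p rest qs → length sup ≢ L → length acc ≤ length sup →
              grill beh S c L sup acc (p ∷ rest) qs ≡ afterAnswer beh c L sup acc p rest qs (answer beh S p c)
  grill-ask beh c L sup acc p rest qs sup≢L acc≤sup =
    trans (unfold-ask sup≢L acc≤sup) (afterAnswer-if (answer beh S p c))
    where
    unfold-ask : length sup ≢ L → length acc ≤ length sup →
      grill beh S c L sup acc (p ∷ rest) qs ≡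
        (if answer beh S p c
         then grill beh S c L sup (acc ++ [ p ]) rest (qs ++ [ (p , c) ])
         else grill beh S c L (sup ++ [ p ]) acc rest (qs ++ [ (p , c) ]))
    unfold-ask sup≢L acc≤sup with length sup ≡ᵇ L in e₁ | length sup <ᵇ length acc in e₂
    ... | true | _ = ⊥-elim (sup≢L (≡ᵇ⇒≡ _ _ (subst T (sym e₁) _)))
    ... | false | true = ⊥-elim (<⇒≱ (<ᵇ⇒< _ _ (subst T (sym e₂) _)) acc≤sup)
    ... | false | false = refl
    afterAnswer-if : ∀ b →
      (if b then grill beh S c L sup (acc ++ [ p ]) rest (qs ++ [ (p , c) ])
       else grill beh S c L (sup ++ [ p ]) acc rest (qs ++ [ (p , c) ])) ≡ afterAnswer beh c L sup acc p rest qs b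
    afterAnswer-if true = refl
    afterAnswer-if false = refl

  asked-one-more : ∀ (qs : List (Question n)) q (rest : List (Fin n)) →
                   length (qs ++ [ q ]) + length rest ≡ length qs + suc (length rest)
  asked-one-more qs q rest = trans (cong (_+ length rest) (length-snoc qs q)) (sym (+-suc (length qs) (length rest)))

  joins : ∀ x (ps : List (Fin n)) p → x + length (ps ++ [ p ]) ≡ suc x + length ps
  joins x ps p = trans (cong (x +_) (length-snoc ps p)) (+-suc x (length ps))

  -- The outcome of grilling a knight candidate, described through the spy
  -- pattern w of the people not yet involved.  The indices record, at the start
  -- of grilling: the value of the walk, #questions + #uninvolved, and the
  -- spies-plus-accusers and knights-plus-supporters counts (both conserved).
  data KnightGrilled (beh : Behaviour) (L run t a b : ℕ) : Grill n → Set where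
    knight-accepted : ∀ {sup acc rest qs} → length sup ≡ L → run ≡ 0 → length qs + length rest ≡ t →
      KnightGrilled beh L run t a b (accepted sup acc rest qs)
    knight-rejected : ∀ {sup acc rest qs} → length acc ≡ suc (length sup) → length acc ≤ L →
      run ≡ suc (fresh beh (spyWord rest)) → length qs + length rest ≡ t →
      a ≡ trues (spyWord rest) + length acc → b ≡ falses (spyWord rest) + length sup →
      KnightGrilled beh L run t a b (rejected sup acc rest qs)

  knightGrilled-cong : ∀ {beh L run run′ t t′ a a′ b b′ R} → run ≡ run′ → t ≡ t′ → a ≡ a′ → b ≡ b′ →
    KnightGrilled beh L run t a b R → KnightGrilled beh L run′ t′ a′ b′ R
  knightGrilled-cong refl refl refl refl g = g

  -- Grilling a knight follows the walk knightRun: the lead h goes up with each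
  -- knight and down with each spy; he is accepted on reaching L supporters
  -- (then no spy is left to overturn his lead) and rejected when his lead
  -- would become negative.
  module KnightCandidate (beh : Behaviour) (c : Fin n) (c-knight : lookup S c ≡ false) (L : ℕ) where
    mutual
      knight-grill : ∀ rest sup acc qs h → length sup ≡ h + length acc → length sup ≤ L →
        trues (spyWord rest) + length acc ≤ L → L ≤ falses (spyWord rest) + length sup →
        KnightGrilled beh L (knightRun beh h (spyWord rest)) (length qs + length rest)
          (trues (spyWord rest) + length acc) (falses (spyWord rest) + length sup)
          (grill beh S c L sup acc rest qs)
      knight-grill rest sup acc qs h lead sup≤L spies≤L L≤knights with length sup ≟ L
      ... | yes sup≡L =
        subst (KnightGrilled beh L _ _ _ _) (sym (grill-accept beh c L sup acc rest qs sup≡L))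
          (knight-accepted sup≡L (knightRun-safe beh h (spyWord rest) no-spy-left) refl)
        where
        no-spy-left : trues (spyWord rest) ≤ h
        no-spy-left = +-cancelʳ-≤ (length acc) _ _ (≤-trans spies≤L (≤-reflexive (trans (sym sup≡L) lead)))
      knight-grill [] sup acc qs h lead sup≤L spies≤L L≤sup | no sup≢L =
        ⊥-elim (sup≢L (≤-antisym sup≤L L≤sup))
      knight-grill (p ∷ rest) sup acc qs h lead sup≤L spies≤L L≤knights | no sup≢L =
        subst (KnightGrilled beh L _ _ _ _)
          (sym (trans (grill-ask beh c L sup acc p rest qs sup≢L acc≤sup)
                      (cong (afterAnswer beh c L sup acc p rest qs) (answer-about-knight beh p c-knight))))
          (knight-answers p rest sup acc qs h (lookup S p) lead (≤∧≢⇒< sup≤L sup≢L) spies≤L L≤knights)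
        where
        acc≤sup : length acc ≤ length sup
        acc≤sup = ≤-trans (m≤n+m (length acc) h) (≤-reflexive (sym lead))

      -- the answer of p, according to his identity b: a spy accusing at lead 0
      -- rejects, a spy accusing at a positive lead or a knight supporting moves on
      knight-answers : ∀ p rest sup acc qs h b → length sup ≡ h + length acc → length sup < L →
        trues (b ∷ spyWord rest) + length acc ≤ L → L ≤ falses (b ∷ spyWord rest) + length sup →
        KnightGrilled beh L (knightRun beh h (b ∷ spyWord rest)) (length qs + suc (length rest))
          (trues (b ∷ spyWord rest) + length acc) (falses (b ∷ spyWord rest) + length sup)
          (afterAnswer beh c L sup acc p rest qs b)
      knight-answers p rest sup acc qs zero true lead sup<L _ _ =
        subst (KnightGrilled beh L _ _ _ _)
          (sym (grill-reject beh c L sup (acc ++ [ p ]) rest (qs ++ [ (p , c) ]) (<⇒≢ sup<L) (≤-reflexive (sym acc′≡))))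
          (knight-rejected acc′≡ (subst (_≤ L) (sym acc′≡) sup<L) refl (asked-one-more qs (p , c) rest)
                           (sym (joins (trues (spyWord rest)) acc p)) refl)
        where
        acc′≡ : length (acc ++ [ p ]) ≡ suc (length sup)
        acc′≡ = trans (length-snoc acc p) (cong suc (sym lead))
      knight-answers p rest sup acc qs (suc h) true lead sup<L spies≤L L≤knights =
        knightGrilled-cong refl (asked-one-more qs (p , c) rest) (joins (trues (spyWord rest)) acc p) refl
          (knight-grill rest sup (acc ++ [ p ]) (qs ++ [ (p , c) ]) h
            (trans lead (trans (sym (+-suc h (length acc))) (cong (h +_) (sym (length-snoc acc p)))))
            (<⇒≤ sup<L) (≤-trans (≤-reflexive (joins (trues (spyWord rest)) acc p)) spies≤L) L≤knights)
      knight-answers p rest sup acc qs h false lead sup<L spies≤L L≤knights =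
        knightGrilled-cong refl (asked-one-more qs (p , c) rest) refl (joins (falses (spyWord rest)) sup p)
          (knight-grill rest (sup ++ [ p ]) acc (qs ++ [ (p , c) ]) (suc h)
            (trans (length-snoc sup p) (cong suc lead))
            (subst (_≤ L) (sym (length-snoc sup p)) sup<L) spies≤L
            (≤-trans L≤knights (≤-reflexive (sym (joins (falses (spyWord rest)) sup p)))))

  -- The outcome of grilling a spy candidate when spies are knavish: he is
  -- always rejected (too few spies remain to give him L supporters).
  data SpyGrilled (L run t a b : ℕ) : Grill n → Set where
    spy-rejected : ∀ {sup acc rest qs} → length acc ≡ suc (length sup) → length acc ≤ L →
      run ≡ fresh knavish (spyWord rest) → length qs + length rest ≡ t →
      a ≡ trues (spyWord rest) + length sup → b ≡ falses (spyWord rest) + length acc →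
      SpyGrilled L run t a b (rejected sup acc rest qs)

  spyGrilled-cong : ∀ {L run t t′ a a′ b b′ R} → t ≡ t′ → a ≡ a′ → b ≡ b′ →
    SpyGrilled L run t a b R → SpyGrilled L run t′ a′ b′ R
  spyGrilled-cong refl refl refl g = g

  module KnavishSpyCandidate (c : Fin n) (c-spy : lookup S c ≡ true) (L : ℕ) where
    mutual
      spy-grill : ∀ rest sup acc qs h → length sup ≡ h + length acc →
        suc (trues (spyWord rest) + length sup) ≤ L → suc L ≤ falses (spyWord rest) + length acc →
        SpyGrilled L (spyRun knavish h (spyWord rest)) (length qs + length rest)
          (trues (spyWord rest) + length sup) (falses (spyWord rest) + length acc)
          (grill knavish S c L sup acc rest qs)
      spy-grill [] sup acc qs h lead sup<L L<acc =
        ⊥-elim (<⇒≱ sup<L (≤-trans (n≤1+n L) (≤-trans L<acc (≤-trans (m≤n+m (length acc) h) (≤-reflexive (sym lead))))))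
      spy-grill (p ∷ rest) sup acc qs h lead spies<L L<knights =
        subst (SpyGrilled L _ _ _ _)
          (sym (trans (grill-ask knavish c L sup acc p rest qs (<⇒≢ sup<L) acc≤sup)
                      (cong (afterAnswer knavish c L sup acc p rest qs) (knavish-answer-about-spy p c-spy))))
          (spy-answers p rest sup acc qs h (lookup S p) lead sup<L spies<L L<knights)
        where
        sup<L : length sup < L
        sup<L = ≤-trans (s≤s (m≤n+m (length sup) (trues (spyWord (p ∷ rest))))) spies<L
        acc≤sup : length acc ≤ length sup
        acc≤sup = ≤-trans (m≤n+m (length acc) h) (≤-reflexive (sym lead))

      spy-answers : ∀ p rest sup acc qs h b → length sup ≡ h + length acc → length sup < L →
        suc (trues (b ∷ spyWord rest) + length sup) ≤ L → suc L ≤ falses (b ∷ spyWord rest) + length acc →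
        SpyGrilled L (spyRun knavish h (b ∷ spyWord rest)) (length qs + suc (length rest))
          (trues (b ∷ spyWord rest) + length sup) (falses (b ∷ spyWord rest) + length acc)
          (afterAnswer knavish c L sup acc p rest qs (not b))
      spy-answers p rest sup acc qs h true lead sup<L spies<L L<knights =
        spyGrilled-cong (asked-one-more qs (p , c) rest) (joins (trues (spyWord rest)) sup p) refl
          (spy-grill rest (sup ++ [ p ]) acc (qs ++ [ (p , c) ]) (suc h)
            (trans (length-snoc sup p) (cong suc lead))
            (≤-trans (s≤s (≤-reflexive (joins (trues (spyWord rest)) sup p))) spies<L) L<knights)
      spy-answers p rest sup acc qs zero false lead sup<L _ _ =
        subst (SpyGrilled L _ _ _ _)
          (sym (grill-reject knavish c L sup (acc ++ [ p ]) rest (qs ++ [ (p , c) ]) (<⇒≢ sup<L) (≤-reflexive (sym acc′≡))))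
          (spy-rejected acc′≡ (subst (_≤ L) (sym acc′≡) sup<L) refl (asked-one-more qs (p , c) rest)
                        refl (sym (joins (falses (spyWord rest)) acc p)))
        where
        acc′≡ : length (acc ++ [ p ]) ≡ suc (length sup)
        acc′≡ = trans (length-snoc acc p) (cong suc (sym lead))
      spy-answers p rest sup acc qs (suc h) false lead sup<L spies<L L<knights =
        spyGrilled-cong (asked-one-more qs (p , c) rest) refl (joins (falses (spyWord rest)) acc p)
          (spy-grill rest sup (acc ++ [ p ]) (qs ++ [ (p , c) ]) h
            (trans lead (trans (sym (+-suc h (length acc))) (cong (h +_) (sym (length-snoc acc p)))))
            spies<L (≤-trans L<knights (≤-reflexive (sym (joins (falses (spyWord rest)) acc p)))))

  spyish-grill : ∀ c L p rest → lookup S c ≡ true →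
    grill spyish S c (suc L) [] [] (p ∷ rest) [] ≡ rejected [] [ p ] rest [ (p , c) ]
  spyish-grill c L p rest c-spy with lookup S p
  ... | true = refl
  ... | false rewrite c-spy = refl

  -- Questions Step 3 asks about a rejected candidate with a accusers:
  -- a - 1 (his supporters) for a knight, a (his accusers) for a spy.
  step3Cost : Rejected n → ℕ
  step3Cost (m , sup , acc) = if lookup S m then length acc else length sup

  -- Questions committed so far: those of Step 1, plus those of Steps 2 and 3
  -- about the rejected candidates.
  committed : List (Rejected n) → List (Question n) → ℕ
  committed rej qs = length qs + length rej + sum (map step3Cost rej)

  totalCost : Step1 n → ℕ
  totalCost (k , supk , rest , rej , qs) = committed rej qs + length rest + length supk

  committed-more-questions : ∀ rej qs gq → committed rej (qs ++ gq) ≡ committed rej qs + length gq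
  committed-more-questions rej qs gq rewrite length-++ qs {gq} =
    rearrange (length qs) (length gq) (length rej) (sum (map step3Cost rej))
    where
    rearrange : ∀ q g r c → q + g + r + c ≡ q + r + c + g
    rearrange = solve-∀

  committed-reject : ∀ rej qs gq x →
    committed (rej ++ [ x ]) (qs ++ gq) ≡ committed rej qs + length gq + suc (step3Cost x)
  committed-reject rej qs gq x
    rewrite length-++ qs {gq} | length-snoc rej x | map-++ step3Cost rej [ x ] | sum-++ (map step3Cost rej) [ step3Cost x ] =
    rearrange (length qs) (length gq) (length rej) (sum (map step3Cost rej)) (step3Cost x)
    where
    rearrange : ∀ q g r c y → (q + g) + suc r + (c + (y + 0)) ≡ (q + r + c) + g + suc y
    rearrange = solve-∀

  acceptance-accounting : ∀ rej qs gq (rest′ sup rest : List (Fin n)) L F →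
    length sup ≡ L → F ≡ 0 → length gq + length rest′ ≡ length rest →
    committed rej (qs ++ gq) + length rest′ + length sup + F + 1 ≡ committed rej qs + suc (length rest) + L
  acceptance-accounting rej qs gq rest′ sup rest L F refl refl asked = begin
    committed rej (qs ++ gq) + length rest′ + length sup + 0 + 1
      ≡⟨ cong (λ x → x + length rest′ + length sup + 0 + 1) (committed-more-questions rej qs gq) ⟩
    committed rej qs + length gq + length rest′ + length sup + 0 + 1
      ≡⟨ regroup (committed rej qs) (length gq) (length rest′) (length sup) ⟩
    committed rej qs + suc (length gq + length rest′) + length sup
      ≡⟨ cong (λ z → committed rej qs + suc z + length sup) asked ⟩
    committed rej qs + suc (length rest) + length sup ∎
    where
    open ≡-Reasoning
    regroup : ∀ P g r L → P + g + r + L + 0 + 1 ≡ P + suc (g + r) + L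
    regroup = solve-∀

  length-concatMap : ∀ {A B : Set} (h : A → List B) xs → length (concatMap h xs) ≡ sum (map (λ x → length (h x)) xs)
  length-concatMap h [] = refl
  length-concatMap h (x ∷ xs) = trans (length-++ (h x)) (cong (length (h x) +_) (length-concatMap h xs))

  laterSteps-length : ∀ beh k supk rest rej qs → lookup S k ≡ false →
    length (laterSteps beh S (k , supk , rest , rej , qs)) ≡ totalCost (k , supk , rest , rej , qs)
  laterSteps-length beh k supk rest rej qs k-knight = begin
    length (qs ++ (step2 ++ step3 ++ step4))
      ≡⟨ length-++ qs ⟩
    length qs + length (step2 ++ step3 ++ step4)
      ≡⟨ cong (length qs +_) (trans (length-++ step2) (cong₂ _+_ (length-++ (map (k ,_) rest)) (length-++ step3))) ⟩
    length qs + ((length (map (k ,_) rest) + length (map (λ r → k , proj₁ r) rej)) + (length step3 + length step4))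
      ≡⟨ cong (λ z → length qs + z) (cong₂ _+_ (cong₂ _+_ (length-map _ rest) (length-map _ rej))
                                                (cong₂ _+_ step3-length (length-map _ supk))) ⟩
    length qs + ((length rest + length rej) + (sum (map step3Cost rej) + length supk))
      ≡⟨ rearrange (length qs) (length rest) (length rej) (sum (map step3Cost rej)) (length supk) ⟩
    totalCost (k , supk , rest , rej , qs) ∎
    where
    open ≡-Reasoning
    askAbout : Rejected n → List (Question n)
    askAbout (m , sup , acc) = if answer beh S k m then map (k ,_) acc else map (k ,_) sup
    step2 step3 step4 : List (Question n)
    step2 = map (k ,_) rest ++ map (λ r → k , proj₁ r) rej
    step3 = concatMap askAbout rej
    step4 = map (k ,_) supk
    askAbout-length : ∀ x → length (askAbout x) ≡ step3Cost x
    askAbout-length (m , sup , acc) rewrite knight-answer beh m k-knight with lookup S m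
    ... | true = length-map (k ,_) acc
    ... | false = length-map (k ,_) sup
    step3-length : length step3 ≡ sum (map step3Cost rej)
    step3-length = trans (length-concatMap askAbout rej) (cong sum (map-cong askAbout-length rej))
    rearrange : ∀ q r j s p → q + ((r + j) + (s + p)) ≡ q + j + s + r + p
    rearrange = solve-∀

  -- What Step 1 achieves from a given state: it ends by accepting a knight,
  -- and the number of questions asked in total, plus the savings (the walk
  -- fresh on the spy word w of the uninvolved people), plus one, equals the
  -- questions committed so far + #uninvolved people + the threshold L.
  Step1Outcome : Behaviour → ℕ → ℕ → List (Fin n) → List Bool → List (Rejected n) → List (Question n) → Set
  Step1Outcome beh f L people w rej qs =
    Σ (Step1 n) λ r → (step1 beh S f L people rej qs ≡ just r) × (lookup S (proj₁ r) ≡ false)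
                    × (totalCost r + fresh beh w + 1 ≡ committed rej qs + length people + L)

  Step1Succeeds : Behaviour → ℕ → Set
  Step1Succeeds beh f = ∀ L rest rej qs → length rest ≤ f →
    trues (spyWord rest) ≤ L → suc L ≤ falses (spyWord rest) → Step1Outcome beh f L rest (spyWord rest) rej qs

  step1-accept : ∀ beh f L c rest rej qs {sup acc rest′ gq} → grill beh S c L [] [] rest [] ≡ accepted sup acc rest′ gq →
    step1 beh S (suc f) L (c ∷ rest) rej qs ≡ just (c , sup , rest′ , rej , qs ++ gq)
  step1-accept beh f L c rest rej qs grilled rewrite grilled = refl

  step1-reject : ∀ beh f L c rest rej qs {sup acc rest′ gq} → grill beh S c L [] [] rest [] ≡ rejected sup acc rest′ gq →
    step1 beh S (suc f) L (c ∷ rest) rej qs ≡ step1 beh S f (L ∸ length acc) rest′ (rej ++ [ (c , sup , acc) ]) (qs ++ gq)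
  step1-reject beh f L c rest rej qs grilled rewrite grilled = refl

  continue-after-rejection : ∀ beh f L c rest rej qs sup acc rest′ gq w d →
    grill beh S c L [] [] rest [] ≡ rejected sup acc rest′ gq →
    length acc ≤ L → step3Cost (c , sup , acc) + d ≡ length acc → length gq + length rest′ ≡ length rest →
    fresh beh w ≡ d + fresh beh (spyWord rest′) →
    Step1Outcome beh f (L ∸ length acc) rest′ (spyWord rest′) (rej ++ [ (c , sup , acc) ]) (qs ++ gq) →
    Step1Outcome beh (suc f) L (c ∷ rest) w rej qs
  continue-after-rejection beh f L c rest rej qs sup acc rest′ gq w d grilled acc≤L saving asked w-saves (r , ends , r-knight , cost) =
    r , trans (step1-reject beh f L c rest rej qs grilled) ends , r-knight ,
    (begin
      totalCost r + fresh beh w + 1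
        ≡⟨ cong (λ z → totalCost r + z + 1) w-saves ⟩
      totalCost r + (d + fresh beh (spyWord rest′)) + 1
        ≡⟨ rejection-accounting (totalCost r) _ (committed rej qs) (length gq) (length rest′)
             (step3Cost (c , sup , acc)) (length acc) L d acc≤L saving
             (trans cost (cong (λ z → z + length rest′ + (L ∸ length acc)) (committed-reject rej qs gq (c , sup , acc)))) ⟩
      committed rej qs + suc (length gq + length rest′) + L
        ≡⟨ cong (λ z → committed rej qs + suc z + L) asked ⟩
      committed rej qs + length (c ∷ rest) + L ∎)
    where open ≡-Reasoning

  -- Conservation of counts: after a rejection with a accusers the next round
  -- again has more than L - a knights available.
  knights-after : ∀ L a F → a ≤ L → suc L ≤ F + a → suc (L ∸ a) ≤ F
  knights-after L a F a≤L L<F+a =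
    +-cancelʳ-≤ a (suc (L ∸ a)) F (≤-trans (≤-reflexive (cong suc (trans (+-comm (L ∸ a) a) (m+[n∸m]≡n a≤L)))) L<F+a)

  knight-round : ∀ beh f L c rest rej qs → lookup S c ≡ false → length rest ≤ f →
    trues (spyWord rest) ≤ L → L ≤ falses (spyWord rest) → Step1Succeeds beh f →
    Step1Outcome beh (suc f) L (c ∷ rest) (false ∷ spyWord rest) rej qs
  knight-round beh f L c rest rej qs c-knight rest≤f spies≤L L≤knights next =
    by-outcome (grill beh S c L [] [] rest []) refl
      (KnightCandidate.knight-grill beh c c-knight L rest [] [] [] 0 refl z≤n
        (subst (_≤ L) (sym (+-identityʳ _)) spies≤L) (subst (L ≤_) (sym (+-identityʳ _)) L≤knights))
    where
    by-outcome : ∀ g → grill beh S c L [] [] rest [] ≡ g →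
      KnightGrilled beh L (knightRun beh 0 (spyWord rest)) (length rest) (trues (spyWord rest) + 0) (falses (spyWord rest) + 0) g →
      Step1Outcome beh (suc f) L (c ∷ rest) (false ∷ spyWord rest) rej qs
    by-outcome (accepted sup acc rest′ gq) grilled (knight-accepted sup≡L no-saving asked) =
      (c , sup , rest′ , rej , qs ++ gq) , step1-accept beh f L c rest rej qs grilled , c-knight ,
      acceptance-accounting rej qs gq rest′ sup rest L _ sup≡L no-saving asked
    by-outcome (rejected sup acc rest′ gq) grilled (knight-rejected acc≡ acc≤L saves asked spies≡ knights≡) =
      continue-after-rejection beh f L c rest rej qs sup acc rest′ gq (false ∷ spyWord rest) 1 grilled acc≤L saving asked saves
        (next (L ∸ length acc) rest′ (rej ++ [ (c , sup , acc) ]) (qs ++ gq)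
          (≤-trans (m≤n+m (length rest′) (length gq)) (≤-trans (≤-reflexive asked) rest≤f))
          (m+n≤o⇒m≤o∸n (trues (spyWord rest′)) (≤-trans (≤-reflexive (sym spies≡)) (subst (_≤ L) (sym (+-identityʳ _)) spies≤L)))
          (knights-after L (length acc) (falses (spyWord rest′)) acc≤L
            (≤-trans (s≤s (≤-trans L≤knights (≤-reflexive (trans (sym (+-identityʳ _)) knights≡))))
                     (≤-reflexive (trans (sym (+-suc _ _)) (cong (falses (spyWord rest′) +_) (sym acc≡)))))))
      where
      saving : step3Cost (c , sup , acc) + 1 ≡ length acc
      saving rewrite c-knight = trans (+-comm (length sup) 1) (sym acc≡)

  knavish-spy-round : ∀ f L c rest rej qs → lookup S c ≡ true → length rest ≤ f →
    suc (trues (spyWord rest)) ≤ L → suc L ≤ falses (spyWord rest) → Step1Succeeds knavish f →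
    Step1Outcome knavish (suc f) L (c ∷ rest) (true ∷ spyWord rest) rej qs
  knavish-spy-round f L c rest rej qs c-spy rest≤f spies<L L<knights next =
    by-outcome (grill knavish S c L [] [] rest []) refl
      (KnavishSpyCandidate.spy-grill c c-spy L rest [] [] [] 0 refl
        (subst (λ z → suc z ≤ L) (sym (+-identityʳ _)) spies<L) (subst (suc L ≤_) (sym (+-identityʳ _)) L<knights))
    where
    by-outcome : ∀ g → grill knavish S c L [] [] rest [] ≡ g →
      SpyGrilled L (spyRun knavish 0 (spyWord rest)) (length rest) (trues (spyWord rest) + 0) (falses (spyWord rest) + 0) g →
      Step1Outcome knavish (suc f) L (c ∷ rest) (true ∷ spyWord rest) rej qs
    by-outcome (rejected sup acc rest′ gq) grilled (spy-rejected acc≡ acc≤L saves asked spies≡ knights≡) =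
      continue-after-rejection knavish f L c rest rej qs sup acc rest′ gq (true ∷ spyWord rest) 0 grilled acc≤L saving asked saves
        (next (L ∸ length acc) rest′ (rej ++ [ (c , sup , acc) ]) (qs ++ gq)
          (≤-trans (m≤n+m (length rest′) (length gq)) (≤-trans (≤-reflexive asked) rest≤f))
          (m+n≤o⇒m≤o∸n (trues (spyWord rest′))
            (≤-trans (≤-reflexive (trans (cong (trues (spyWord rest′) +_) acc≡)
                                         (trans (+-suc _ _) (cong suc (trans (sym spies≡) (+-identityʳ _))))))
                     spies<L))
          (knights-after L (length acc) (falses (spyWord rest′)) acc≤L
            (≤-trans L<knights (≤-reflexive (trans (sym (+-identityʳ _)) knights≡)))))
      where
      saving : step3Cost (c , sup , acc) + 0 ≡ length acc
      saving rewrite c-spy = +-identityʳ (length acc)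

  spyish-spy-round : ∀ f L c rest rej qs → lookup S c ≡ true → length rest ≤ f →
    suc (trues (spyWord rest)) ≤ L → suc L ≤ falses (spyWord rest) → Step1Succeeds spyish f →
    Step1Outcome spyish (suc f) L (c ∷ rest) (true ∷ spyWord rest) rej qs
  spyish-spy-round f L c [] rej qs c-spy _ _ () next
  spyish-spy-round f (suc L) c (p ∷ rest) rej qs c-spy rest≤f spies<L L<knights next =
    continue-after-rejection spyish f (suc L) c (p ∷ rest) rej qs [] [ p ] rest [ (p , c) ]
      (true ∷ spyWord (p ∷ rest)) 0 (spyish-grill c L p rest c-spy) (s≤s z≤n) saving refl refl
      (next L rest (rej ++ [ (c , [] , [ p ]) ]) (qs ++ [ (p , c) ]) (<⇒≤ rest≤f)
        (≤-trans (trues-cons (lookup S p) (spyWord rest)) (≤-pred spies<L))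
        (≤-pred (≤-trans L<knights (falses-cons (lookup S p) (spyWord rest)))))
    where
    saving : step3Cost (c , [] , [ p ]) + 0 ≡ 1
    saving rewrite c-spy = refl

  spy-round : ∀ beh f L c rest rej qs → lookup S c ≡ true → length rest ≤ f →
    suc (trues (spyWord rest)) ≤ L → suc L ≤ falses (spyWord rest) → Step1Succeeds beh f →
    Step1Outcome beh (suc f) L (c ∷ rest) (true ∷ spyWord rest) rej qs
  spy-round knavish = knavish-spy-round
  spy-round spyish = spyish-spy-round

  step1-succeeds : ∀ beh f → Step1Succeeds beh f
  step1-succeeds beh f L [] rej qs _ _ ()
  step1-succeeds beh zero L (c ∷ rest) rej qs () _ _
  step1-succeeds beh (suc f) L (c ∷ rest) rej qs (s≤s rest≤f) =
    by-identity (lookup S c) refl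
    where
    by-identity : ∀ b → lookup S c ≡ b → trues (b ∷ spyWord rest) ≤ L → suc L ≤ falses (b ∷ spyWord rest) →
                  Step1Outcome beh (suc f) L (c ∷ rest) (b ∷ spyWord rest) rej qs
    by-identity false c-knight spies≤L L<knights =
      knight-round beh f L c rest rej qs c-knight rest≤f spies≤L (≤-pred L<knights) (step1-succeeds beh f)
    by-identity true c-spy spies<L L<knights =
      spy-round beh f L c rest rej qs c-spy rest≤f spies<L L<knights (step1-succeeds beh f)

  tabulate-lookup : ∀ {m} (V : Vec Bool m) → tabulate (lookup V) ≡ toList V
  tabulate-lookup []ᵥ = refl
  tabulate-lookup (x ∷ᵥ V) = cong (x ∷_) (tabulate-lookup V)

  spyWord-everyone : spyWord (allFin n) ≡ toList S
  spyWord-everyone = trans (map-tabulate (λ i → i) (lookup S)) (tabulate-lookup S)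

  spiderQuestions-after-step1 : ∀ beh ℓ r → step1 beh S n ℓ (allFin n) [] [] ≡ just r →
                                spiderQuestions beh ℓ S ≡ laterSteps beh S r
  spiderQuestions-after-step1 beh ℓ r ends rewrite ends = refl

  questions+savings : ∀ beh ℓ → trues (toList S) ≤ ℓ → suc ℓ ≤ falses (toList S) →
                      numQuestions beh ℓ S + fresh beh (toList S) + 1 ≡ n + ℓ
  questions+savings beh ℓ spies≤ℓ ℓ<knights =
    from-outcome (step1-succeeds beh n ℓ (allFin n) [] [] (≤-reflexive (length-tabulate (λ i → i)))
                   (subst (_≤ ℓ) (cong trues (sym spyWord-everyone)) spies≤ℓ)
                   (subst (suc ℓ ≤_) (cong falses (sym spyWord-everyone)) ℓ<knights))
    where
    open ≡-Reasoning
    from-outcome : Step1Outcome beh n ℓ (allFin n) (spyWord (allFin n)) [] [] →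
                   numQuestions beh ℓ S + fresh beh (toList S) + 1 ≡ n + ℓ
    from-outcome (r@(k , supk , rest , rej , qs) , ends , k-knight , cost) = begin
      numQuestions beh ℓ S + fresh beh (toList S) + 1
        ≡⟨ cong (λ q → q + fresh beh (toList S) + 1)
                (trans (cong length (spiderQuestions-after-step1 beh ℓ r ends))
                       (laterSteps-length beh k supk rest rej qs k-knight)) ⟩
      totalCost r + fresh beh (toList S) + 1
        ≡⟨ cong (λ w → totalCost r + fresh beh w + 1) (sym spyWord-everyone) ⟩
      totalCost r + fresh beh (spyWord (allFin n)) + 1
        ≡⟨ cost ⟩
      length (allFin n) + ℓ
        ≡⟨ cong (_+ ℓ) (length-tabulate (λ i → i)) ⟩
      n + ℓ ∎

module Rooms (k s ℓ : ℕ) (s≤ℓ : s ≤ ℓ) (2ℓ<n : 2 * ℓ < k + s) where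

  -- More knights than the threshold: 2ℓ < k + s ≤ k + ℓ.
  ℓ<k : ℓ < k
  ℓ<k = +-cancelʳ-≤ ℓ (suc ℓ) k (begin
    suc ℓ + ℓ       ≡⟨ cong (λ z → suc (ℓ + z)) (sym (+-identityʳ ℓ)) ⟩
    suc (2 * ℓ)     ≤⟨ 2ℓ<n ⟩
    k + s           ≤⟨ +-monoʳ-≤ k s≤ℓ ⟩
    k + ℓ ∎)
    where open ≤-Reasoning

  s≤k : s ≤ k
  s≤k = ≤-trans s≤ℓ (<⇒≤ ℓ<k)

  rooms-have-s-spies : All (λ S → spies S ≡ s) (roomsWith (k + s) s)
  rooms-have-s-spies = All.all-filter (λ S → spies S ≟ s) (allRooms (k + s))

  room-cost : ∀ beh S → spies S ≡ s → numQuestions beh ℓ S + fresh beh (toList S) + 1 ≡ k + s + ℓ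
  room-cost beh S has-s = Interrogation.questions+savings S beh ℓ
      (subst (_≤ ℓ) (sym spies≡s) s≤ℓ) (subst (suc ℓ ≤_) (sym knights≡k) ℓ<k)
    where
    spies≡s : trues (toList S) ≡ s
    spies≡s = trans (trues-toList S) has-s
    knights≡k : falses (toList S) ≡ k
    knights≡k = +-cancelʳ-≡ s _ _
      (trans (cong (falses (toList S) +_) (sym spies≡s)) (trans (falses+trues (toList S)) (length-toList S)))

  questions-asked : ∀ beh S → spies S ≡ s → numQuestions beh ℓ S ≡ (k + s + ℓ) ∸ suc (fresh beh (toList S))
  questions-asked beh S has-s = begin
    q                                   ≡⟨ m+n∸n≡m q (suc z) ⟨
    q + suc z ∸ suc z                   ≡⟨ cong (_∸ suc z) (trans (+-suc q z) (sym (+-comm (q + z) 1))) ⟩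
    q + z + 1 ∸ suc z                   ≡⟨ cong (_∸ suc z) (room-cost beh S has-s) ⟩
    k + s + ℓ ∸ suc z ∎
    where
    open ≡-Reasoning
    q = numQuestions beh ℓ S
    z = fresh beh (toList S)

  questions-saved : ∀ beh S → spies S ≡ s → saved beh ℓ S ≡ fresh beh (toList S)
  questions-saved beh S has-s = begin
    (k + s + ℓ ∸ 1) ∸ q     ≡⟨ cong (λ t → (t ∸ 1) ∸ q) (room-cost beh S has-s) ⟨
    (q + z + 1 ∸ 1) ∸ q     ≡⟨ cong (_∸ q) (m+n∸n≡m (q + z) 1) ⟩
    (q + z) ∸ q             ≡⟨ m+n∸m≡n q z ⟩
    z ∎
    where
    open ≡-Reasoning
    q = numQuestions beh ℓ S
    z = fresh beh (toList S)

  countQ-via-savings : ∀ beh q →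
    countQ (k + s) s beh ℓ q ≡ ΣW k s (λ w → if does ((k + s + ℓ) ∸ suc (fresh beh w) ≟ q) then 1 else 0)
  countQ-via-savings beh q =
    trans (length-filter-sum (λ S → numQuestions beh ℓ S ≟ q) (roomsWith (k + s) s))
   (trans (sum-map-All (All.map (λ {S} has-s → cong (λ m → if does (m ≟ q) then 1 else 0) (questions-asked beh S has-s))
                                rooms-have-s-spies))
          (sym (sum-map-∘ (λ w → if does ((k + s + ℓ) ∸ suc (fresh beh w) ≟ q) then 1 else 0) toList (roomsWith (k + s) s))))

  totalSaved-via-savings : ∀ beh → totalSaved (k + s) s beh ℓ ≡ ΣW k s (fresh beh)
  totalSaved-via-savings beh =
    trans (sum-map-All (All.map (λ {S} → questions-saved beh S) rooms-have-s-spies))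
          (sym (sum-map-∘ (fresh beh) toList (roomsWith (k + s) s)))

theorem1 : (k s ℓ : ℕ) → 1 ≤ ℓ → s ≤ ℓ → 2 * ℓ < k + s →
    ((q : ℕ) → countQ (k + s) s knavish ℓ q ≡ countQ (k + s) s spyish ℓ q)
    × ((beh : Behaviour) →
        totalSaved (k + s) s beh ℓ ≡ binomSum (k + s) s)
theorem1 k s ℓ _ s≤ℓ 2ℓ<n = same-distribution , expected-savings
  where
  open Rooms k s ℓ s≤ℓ 2ℓ<n
  same-distribution : ∀ q → countQ (k + s) s knavish ℓ q ≡ countQ (k + s) s spyish ℓ q
  same-distribution q =
    trans (countQ-via-savings knavish q)
   (trans (savings-equidistributed k s s≤k (λ z → if does ((k + s + ℓ) ∸ suc z ≟ q) then 1 else 0))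
          (sym (countQ-via-savings spyish q)))
  expected-savings : ∀ beh → totalSaved (k + s) s beh ℓ ≡ binomSum (k + s) s
  expected-savings beh = trans (totalSaved-via-savings beh) (savings-total k s s≤k beh)
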